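{- Let $H$ be a graph and let $S$ be an independent set of $H$ with $|S|=\alpha(H)$. If $G$ is the graph obtained from the disjoint union of $H$ and a new vertex $x$ by joining $x$ to each vertex of $S$, then ${\rm gp}(G)\ge \alpha(H)$.
   Context: All graphs are simple. $\alpha(H)$ denotes the independence number of $H$ (maximum size of a set of pairwise non-adjacent vertices). A set $X\subseteq V(G)$ is a general position set of $G$ if no three distinct vertices of $X$ lie on a common shortest path (geodesic) of $G$; ${\rm gp}(G)$ is the maximum cardinality of a general position set of $G$. -}

module Defs where

open import Data.Nat using (ℕ; zero; suc; _≤_)
open import Data.Bool using (Bool; true; false)
open import Data.Fin using (Fin; zero; suc)
open import Data.Fin.Subset using (Subset; _∈_; ∣_∣)
open import Data.Vec using (lookup)
open import Data.Product using (_×_; ∃)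
open import Relation.Nullary using (¬_)
open import Relation.Binary.PropositionalEquality using (_≡_; _≢_; refl)

record Graph (n : ℕ) : Set where
  field
    adj   : Fin n → Fin n → Bool
    irrefl : ∀ v → adj v v ≡ false
    sym    : ∀ u v → adj u v ≡ adj v u
open Graph public

Independent : ∀ {n} → Graph n → Subset n → Set
Independent G S = ∀ u v → u ∈ S → v ∈ S → adj G u v ≡ false

IsIndependenceNumber : ∀ {n} → Graph n → ℕ → Set
IsIndependenceNumber {n} G a =
  (∃ λ (S : Subset n) → Independent G S × ∣ S ∣ ≡ a) ×
  (∀ (S : Subset n) → Independent G S → ∣ S ∣ ≤ a)

data Walk {n} (G : Graph n) : Fin n → Fin n → ℕ → Set where
  []  : ∀ {u} → Walk G u u zero
  _∷_ : ∀ {u v w k} → adj G u v ≡ true → Walk G v w k → Walk G u w (suc k)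

data OnWalk {n} {G : Graph n} (z : Fin n) : ∀ {u w k} → Walk G u w k → Set where
  here  : ∀ {w k} {p : Walk G z w k} → OnWalk z p
  there : ∀ {u v w k} {e : adj G u v ≡ true} {p : Walk G v w k} →
          OnWalk z p → OnWalk z (_∷_ {u = u} e p)

IsGeodesic : ∀ {n} {G : Graph n} {u w k} → Walk G u w k → Set
IsGeodesic {G = G} {u} {w} {k} _ = ∀ k' → Walk G u w k' → k ≤ k'

GeneralPosition : ∀ {n} → Graph n → Subset n → Set
GeneralPosition {n} G X =
  ∀ (a b c : Fin n) → a ∈ X → b ∈ X → c ∈ X → a ≢ b → b ≢ c → a ≢ c →
  ∀ (u w : Fin n) (k : ℕ) (p : Walk G u w k) → IsGeodesic p →
  ¬ (OnWalk a p × OnWalk b p × OnWalk c p)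

IsGPNumber : ∀ {n} → Graph n → ℕ → Set
IsGPNumber {n} G g =
  (∃ λ (X : Subset n) → GeneralPosition G X × ∣ X ∣ ≡ g) ×
  (∀ (X : Subset n) → GeneralPosition G X → ∣ X ∣ ≤ g)

-- G obtained from H + new vertex x (= zero) joined to each vertex of S; H's vertex i is suc i.
extAdj : ∀ {n} → Graph n → Subset n → Fin (suc n) → Fin (suc n) → Bool
extAdj H S zero    zero    = false
extAdj H S zero    (suc j) = lookup S j
extAdj H S (suc i) zero    = lookup S i
extAdj H S (suc i) (suc j) = adj H i j

extIrrefl : ∀ {n} (H : Graph n) (S : Subset n) v → extAdj H S v v ≡ false
extIrrefl H S zero    = refl
extIrrefl H S (suc i) = irrefl H i

extSym : ∀ {n} (H : Graph n) (S : Subset n) u v → extAdj H S u v ≡ extAdj H S v u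
extSym H S zero    zero    = refl
extSym H S zero    (suc j) = refl
extSym H S (suc i) zero    = refl
extSym H S (suc i) (suc j) = sym H i j

addApex : ∀ {n} → Graph n → Subset n → Graph (suc n)
addApex H S = record { adj = extAdj H S ; irrefl = extIrrefl H S ; sym = extSym H S }

{-# OPTIONS --safe #-}
-- In G every two vertices of S are non-adjacent but have the common neighbour x,
-- so any walk meeting three of them spends at least 4 steps between the outer two
-- and can be shortened by the 2-step detour through x.
module Submission where

open import Defs
open import Data.Nat using (ℕ; suc; _+_; _≤_; _<_; s≤s)
open import Data.Nat.Properties using (≤-refl; m≤n⇒m≤1+n; <⇒≱)
open import Data.Fin using (zero)
open import Data.Fin.Subset using (Subset; ∣_∣; _∈_; outside)
open import Data.Vec using (_∷_; there)
open import Data.Vec.Properties using ([]=⇒lookup)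
open import Data.Bool.Properties using (not-¬)
open import Data.Product using (_×_; _,_; ∃-syntax)
open import Data.Empty using (⊥-elim)
open import Relation.Binary.PropositionalEquality using (_≡_; _≢_; refl; subst)

module _ {n} (G : Graph n) where

  _++ʷ_ : ∀ {u v w j k} → Walk G u v j → Walk G v w k → Walk G u w (j + k)
  []      ++ʷ q = q
  (e ∷ p) ++ʷ q = e ∷ (p ++ʷ q)

  suffix : ∀ {z u w k} {p : Walk G u w k} → OnWalk z p → ∃[ m ] Walk G z w m × m ≤ k
  suffix {p = p} here = _ , p , ≤-refl
  suffix (there q) with suffix q
  ... | m , r , m≤k = m , r , m≤n⇒m≤1+n m≤k

  module _ (X : Subset n) (X-independent : Independent G X) where

    nonadjacent-suffix : ∀ {b c u w k} {p : Walk G u w k} → b ∈ X → c ∈ X → b ≢ c →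
                         OnWalk b p → OnWalk c p →
                         ∃[ z ] z ∈ X × ∃[ m ] Walk G z w m × 2 + m ≤ k
    nonadjacent-suffix bX cX b≢c here here = ⊥-elim (b≢c refl)
    nonadjacent-suffix bX cX b≢c (there qb) (there qc)
      with nonadjacent-suffix bX cX b≢c qb qc
    ... | z , zX , m , r , le = z , zX , m , r , m≤n⇒m≤1+n le
    nonadjacent-suffix bX cX b≢c here (there {e = e} here) =
      ⊥-elim (not-¬ e (X-independent _ _ bX cX))
    nonadjacent-suffix bX cX b≢c here (there (there qc)) with suffix qc
    ... | m , r , le = _ , cX , m , r , s≤s (s≤s le)
    nonadjacent-suffix bX cX b≢c (there {e = e} here) here =
      ⊥-elim (not-¬ e (X-independent _ _ cX bX))
    nonadjacent-suffix bX cX b≢c (there (there qb)) here with suffix qb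
    ... | m , r , le = _ , bX , m , r , s≤s (s≤s le)

    module _ (detour : ∀ u v → u ∈ X → v ∈ X → Walk G u v 2) where

      shortcut : ∀ {a b c u w k} {p : Walk G u w k} → a ∈ X → b ∈ X → c ∈ X →
                 a ≢ b → b ≢ c → a ≢ c → OnWalk a p → OnWalk b p → OnWalk c p →
                 ∃[ k' ] Walk G u w k' × k' < k
      shortcut _ _ _ a≢b _ _ here here _ = ⊥-elim (a≢b refl)
      shortcut _ _ _ _ _ a≢c here _ here = ⊥-elim (a≢c refl)
      shortcut _ _ _ _ b≢c _ _ here here = ⊥-elim (b≢c refl)
      shortcut aX bX cX a≢b b≢c a≢c (there {e = e} qa) (there qb) (there qc)
        with shortcut aX bX cX a≢b b≢c a≢c qa qb qc
      ... | k' , r , lt = suc k' , e ∷ r , s≤s lt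
      shortcut aX bX cX _ b≢c _ here (there qb) (there qc)
        with nonadjacent-suffix bX cX b≢c qb qc
      ... | z , zX , m , r , le = 2 + m , detour _ z aX zX ++ʷ r , s≤s le
      shortcut aX bX cX _ _ a≢c (there qa) here (there qc)
        with nonadjacent-suffix aX cX a≢c qa qc
      ... | z , zX , m , r , le = 2 + m , detour _ z bX zX ++ʷ r , s≤s le
      shortcut aX bX cX a≢b _ _ (there qa) (there qb) here
        with nonadjacent-suffix aX bX a≢b qa qb
      ... | z , zX , m , r , le = 2 + m , detour _ z cX zX ++ʷ r , s≤s le

      independent∧detours⇒generalPosition : GeneralPosition G X
      independent∧detours⇒generalPosition a b c aX bX cX a≢b b≢c a≢c _ _ _ _ geodesic
                                          (qa , qb , qc)
        with shortcut aX bX cX a≢b b≢c a≢c qa qb qc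
      ... | k' , r , k'<k = <⇒≱ k'<k (geodesic k' r)

S⁺ : ∀ {n} → Subset n → Subset (suc n)
S⁺ S = outside ∷ S

module _ {n} (H : Graph n) (S : Subset n) where

  S⁺-independent : Independent H S → Independent (addApex H S) (S⁺ S)
  S⁺-independent S-independent _ _ (there iS) (there jS) = S-independent _ _ iS jS

  detour-via-apex : ∀ u v → u ∈ S⁺ S → v ∈ S⁺ S → Walk (addApex H S) u v 2
  detour-via-apex _ _ (there iS) (there jS) =
    _∷_ {v = zero} ([]=⇒lookup iS) ([]=⇒lookup jS ∷ [])

  S⁺-generalPosition : Independent H S → GeneralPosition (addApex H S) (S⁺ S)
  S⁺-generalPosition S-independent =
    independent∧detours⇒generalPosition (addApex H S) (S⁺ S)
      (S⁺-independent S-independent) detour-via-apex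

proposition3p2 : ∀ {n : ℕ} (H : Graph n) (S : Subset n) (a g : ℕ) →
    IsIndependenceNumber H a → Independent H S → ∣ S ∣ ≡ a →
    IsGPNumber (addApex H S) g → a ≤ g
-- ∣ S⁺ S ∣ reduces to ∣ S ∣.
proposition3p2 H S a g _ S-independent ∣S∣≡a (_ , gp-maximum) =
  subst (_≤ g) ∣S∣≡a (gp-maximum (S⁺ S) (S⁺-generalPosition H S S-independent))
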